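{- Let $G$ be a connected graph of order $n\geq 4$ and let $(G,\sigma)$ be a balanced signed graph. Then $C(G,\sigma)\leq \frac{n}{2}-2$. Moreover, for every even $n\geq 4$ there is a connected balanced signed graph of order $n$ with confusion number exactly $\frac{n}{2}-2$.
   Context: A signed graph $(G,\sigma)$ is a finite simple graph $G$ with a map $\sigma\colon E(G)\to\{+,-\}$ ($\{\pm\}$ viewed as a multiplicative group). $(G,\sigma)$ is balanced if every circuit contains an even number of negative edges. Information dissemination (ID) process on $(G,\sigma)$: each vertex has a state in $\{A,-A,C,0\}$, initially all $0$. In step $i\geq 1$: choose a vertex $v_i$ of state $0$ (a placement vertex) and set its state to $A$. Then, simultaneously for every vertex $v$ currently in state $0$, consider its neighbours $z$ currently in state $A$ or $-A$ (states after placing $v_i$, before this step's updates); each such $z$ sends $\sigma(vz)\cdot\mathrm{state}(z)$ (with $-(-A)=A$). If $v$ has no such neighbour it stays $0$; if all sent values are equal, $v$ takes that value; if two sent values differ, $v$ gets state $C$ (confused). Vertices with state $A$, $-A$ or $C$ keep their state. Repeat until no vertex has state $0$. The value of the run is the number of vertices of final state $C$. The confusion number $C(G,\sigma)$ is the minimum value over all possible runs. -}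

module Defs where

open import Data.Nat using (ℕ; zero; suc; _+_; _*_; _≤_)
open import Data.Fin using (Fin)
open import Data.Fin.Properties using (_≟_)
open import Data.List using (List; []; _∷_; foldr; length; filter)
open import Data.List.Base using (allFin)
open import Data.List.Relation.Unary.Unique.Propositional using (Unique)
open import Data.Maybe using (Maybe; just; nothing)
open import Data.Product using (Σ; _×_; _,_)
open import Relation.Binary.PropositionalEquality using (_≡_; _≢_; refl)
open import Data.Empty using (⊥)
open import Relation.Nullary using (yes; no; ¬_)

data Sign : Set where
  pos neg : Sign

_·_ : Sign → Sign → Sign
pos · s = s
neg · pos = neg
neg · neg = pos

-- Signed (finite simple) graphs on vertex set Fin n.
-- edge u v = nothing : u, v not adjacent
-- edge u v = just s  : u, v adjacent, the edge uv has sign s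

record SignedGraph (n : ℕ) : Set where
  field
    edge    : Fin n → Fin n → Maybe Sign
    symm    : ∀ u v → edge u v ≡ edge v u
    irrefl  : ∀ u → edge u u ≡ nothing

open SignedGraph public

Adj : ∀ {n} → SignedGraph n → Fin n → Fin n → Set
Adj G u v = Σ Sign λ s → edge G u v ≡ just s

data Walk {n} (G : SignedGraph n) : Fin n → Fin n → Set where
  [] : ∀ {u} → Walk G u u
  _∷_ : ∀ {u v w} → Adj G u v → Walk G v w → Walk G u w

Connected : ∀ {n} → SignedGraph n → Set
Connected G = ∀ u v → Walk G u v

data PathSign {n} (G : SignedGraph n) : Fin n → List (Fin n) → Fin n → Sign → Set where
  end  : ∀ {x} → PathSign G x [] x pos
  step : ∀ {x y ys z s t} → edge G x y ≡ just s → PathSign G y ys z t →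
         PathSign G x (y ∷ ys) z (s · t)

-- (x ∷ xs) is a circuit (cycle of length k = 1 + length xs ≥ 3, distinct
-- vertices) and s is the product of the signs of its edges
Circuit : ∀ {n} → SignedGraph n → List (Fin n) → Sign → Set
Circuit G [] s = ⊥
Circuit {n} G (x ∷ xs) s =
  Unique (x ∷ xs) × 2 ≤ length xs ×
  Σ (Fin n) λ z → Σ Sign λ s₁ → Σ Sign λ s₂ →
    PathSign G x xs z s₁ × edge G z x ≡ just s₂ × s ≡ s₁ · s₂

-- balanced: every circuit has an even number of negative edges,
-- i.e. the product of its edge signs is +
Balanced : ∀ {n} → SignedGraph n → Set
Balanced G = ∀ vs s → Circuit G vs s → s ≡ pos

data State : Set where
  A mA C Z : State     -- A, -A, C (confused), 0

Config : ℕ → Set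
Config n = Fin n → State

act : Sign → State → State
act pos x = x
act neg A = mA
act neg mA = A
act neg x = x

data Recv : Set where
  none     : Recv
  one      : State → Recv
  conflict : Recv

addRecv : State → Recv → Recv
addRecv x none = one x
addRecv A (one A) = one A
addRecv mA (one mA) = one mA
addRecv _ (one _) = conflict
addRecv _ conflict = conflict

send : Maybe Sign → State → Recv → Recv
send (just s) A r = addRecv (act s A) r
send (just s) mA r = addRecv (act s mA) r
send _ _ r = r

received : ∀ {n} → SignedGraph n → Config n → Fin n → Recv
received {n} G c v = foldr (λ z r → send (edge G v z) (c z) r) none (allFin n)

place : ∀ {n} → Config n → Fin n → Config n
place c v w with w ≟ v
... | yes _ = A
... | no _ = c w

update : Recv → State
update none = Z
update (one x) = x
update conflict = C

spread : ∀ {n} → SignedGraph n → Config n → Config n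
spread G c w with c w
... | Z = update (received G c w)
... | x = x

stepID : ∀ {n} → SignedGraph n → Config n → Fin n → Config n
stepID G c v = spread G (place c v)

initial : ∀ {n} → Config n
initial _ = Z

countC : ∀ {n} → Config n → ℕ
countC {n} c = length (filter (λ v → isC (c v)) (allFin n))
  where
  open import Relation.Nullary using (Dec)
  isC : (x : State) → Dec (x ≡ C)
  isC A = no (λ ())
  isC mA = no (λ ())
  isC C = yes refl
  isC Z = no (λ ())

-- Run G c k : starting from configuration c, some run of the ID process
-- ends with exactly k confused vertices
data Run {n} (G : SignedGraph n) : Config n → ℕ → Set where
  done  : ∀ {c} → (∀ v → c v ≢ Z) → Run G c (countC c)
  move : ∀ {c k} (v : Fin n) → c v ≡ Z → Run G (stepID G c v) k → Run G c k

IsConfusionNumber : ∀ {n} → SignedGraph n → ℕ → Set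
IsConfusionNumber G k = Run G initial k × (∀ k' → Run G initial k' → k ≤ k')

-- A connected balanced signed graph has a marking t with σ(uv) = t(u)·t(v): take t(v) to be the
-- sign of any walk from a fixed root, which is well defined because erasing loops from a walk keeps
-- its sign (each erased loop is a circuit or an edge walked back and forth).  Replacing t by -t if
-- necessary, at most half of the vertices are negative.  While A is only placed on positive vertices
-- every informed vertex w is in state t(w)·A, so nobody is confused.  Place A first on a positive
-- neighbour of a negative vertex x, then on positive vertices until only negative ones are
-- uninformed; one more placement then confuses at most the negative vertices other than itself
-- and x, i.e. at most n/2 - 2 of them.
-- For the lower bound take two copies of K_(m+2) with positive edges joined by a perfect matching
-- of negative edges.  After the first placement exactly the m + 1 vertices of the other copy other
-- than the partner of the placed vertex are uninformed; the second placement, necessarily on one of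
-- them, sends A to the remaining m while the partner sends -A, so exactly m vertices get confused.

module Submission where

open import Defs
open import Data.Nat using (ℕ; _+_; _*_; _≤_)
open import Data.Product using (Σ; _×_)

open import Data.Nat using (zero; suc; _<_; z≤n; s≤s) renaming (_≟_ to _≟ℕ_)
open import Data.Nat.Properties
  using (≤-trans; ≤-reflexive; ≤-total; <-≤-trans; m≤n⇒m≤1+n; <⇒≢; ≮⇒≥; +-suc; +-comm; +-identityʳ;
         +-monoʳ-≤; +-monoˡ-≤; *-monoʳ-≤; *-suc; *-distribˡ-+; suc-injective; anyUpTo?; module ≤-Reasoning)
open import Data.Nat.Induction using (<-wellFounded)
open import Induction.WellFounded using (Acc; acc)
open import Data.Fin using (Fin; zero; suc)
open import Data.Fin.Properties using (_≟_; any?) renaming (suc-injective to Fin-suc-injective)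
open import Data.List using (List; []; _∷_; _++_; _∷ʳ_; [_]; length; filter; foldr; tabulate; allFin)
open import Data.List.Properties
  using (∷ʳ-++; length-tabulate; filter-none; filter-some; filter-≐)
open import Data.List.Membership.Propositional using (_∈_; lose)
open import Data.List.Membership.Propositional.Properties using (∈-∃++; ∈-allFin)
import Data.List.Membership.DecPropositional as DecMembership
open import Data.List.Relation.Unary.Any using (here; there)
open import Data.List.Relation.Unary.All as All using (All; []; _∷_)
open import Data.List.Relation.Unary.All.Properties using (¬Any⇒All¬; ++⁻ˡ)
open import Data.List.Relation.Unary.AllPairs using ([]; _∷_)
open import Data.List.Relation.Unary.Unique.Propositional using (Unique)
open import Data.List.Relation.Unary.Unique.Propositional.Properties using (Unique[x∷xs]⇒x∉xs; allFin⁺)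
open import Data.List.Relation.Binary.Sublist.Propositional using (⊆-refl)
open import Data.List.Relation.Binary.Sublist.Propositional.Properties using (filter⁺; length-mono-≤)
open import Data.Maybe using (Maybe; just; nothing)
open import Data.Maybe.Properties using (just-injective)
open import Data.Product using (_,_; proj₁; proj₂; ∃; ∃₂)
open import Data.Sum using (_⊎_; inj₁; inj₂; [_,_]′)
open import Data.Empty using (⊥-elim)
open import Function using (id; _∘_; case_of_)
open import Level using (0ℓ)
open import Relation.Nullary using (¬_; Dec; yes; no; ¬?; _×-dec_; _⊎-dec_; map′)
open import Relation.Unary using (Pred; Decidable; _⊆_; _≐_)
open import Relation.Binary using (DecidableEquality)
open import Relation.Binary.Construct.Closure.ReflexiveTransitive using (Star; ε; _◅_)
open import Relation.Binary.PropositionalEquality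
  using (_≡_; _≢_; refl; sym; trans; cong; cong₂; subst; subst₂; module ≡-Reasoning)

infix 4 _≟ˢ_

_≟ˢ_ : DecidableEquality Sign
pos ≟ˢ pos = yes refl
pos ≟ˢ neg = no λ ()
neg ≟ˢ pos = no λ ()
neg ≟ˢ neg = yes refl

pos≢neg : pos ≢ neg
pos≢neg ()

≢pos⇒≡neg : ∀ {s} → s ≢ pos → s ≡ neg
≢pos⇒≡neg {pos} s≢pos = ⊥-elim (s≢pos refl)
≢pos⇒≡neg {neg} _ = refl

≢-two-valued : ∀ {a b c : Sign} → a ≢ c → b ≢ c → a ≡ b
≢-two-valued {pos} {pos} _ _ = refl
≢-two-valued {neg} {neg} _ _ = refl
≢-two-valued {pos} {neg} {pos} a≢c _ = ⊥-elim (a≢c refl)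
≢-two-valued {pos} {neg} {neg} _ b≢c = ⊥-elim (b≢c refl)
≢-two-valued {neg} {pos} {pos} _ b≢c = ⊥-elim (b≢c refl)
≢-two-valued {neg} {pos} {neg} a≢c _ = ⊥-elim (a≢c refl)

·-identityʳ : ∀ s → s · pos ≡ s
·-identityʳ pos = refl
·-identityʳ neg = refl

·-inverse : ∀ s → s · s ≡ pos
·-inverse pos = refl
·-inverse neg = refl

·-comm : ∀ a b → a · b ≡ b · a
·-comm pos b = sym (·-identityʳ b)
·-comm neg pos = refl
·-comm neg neg = refl

·-assoc : ∀ a b c → (a · b) · c ≡ a · (b · c)
·-assoc pos b c = refl
·-assoc neg pos c = refl
·-assoc neg neg pos = refl
·-assoc neg neg neg = refl

·-cancelˡ : ∀ s {a b} → s · a ≡ s · b → a ≡ b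
·-cancelˡ pos eq = eq
·-cancelˡ neg {pos} {pos} _ = refl
·-cancelˡ neg {neg} {neg} _ = refl

·-cancelʳ : ∀ a b → (a · b) · b ≡ a
·-cancelʳ a b = trans (·-assoc a b b) (trans (cong (a ·_) (·-inverse b)) (·-identityʳ a))

·-cancel-middle : ∀ a b c → (a · b) · (b · c) ≡ a · c
·-cancel-middle a b c =
  trans (·-assoc a b (b · c)) (cong (a ·_) (trans (sym (·-assoc b b c)) (cong (_· c) (·-inverse b))))

·-switch : ∀ s a b → (s · a) · (s · b) ≡ a · b
·-switch s a b = trans (cong (_· (s · b)) (·-comm s a)) (·-cancel-middle a s b)

x·[y·z]≡pos⇒y≡x·z : ∀ x y z → x · (y · z) ≡ pos → y ≡ x · z
x·[y·z]≡pos⇒y≡x·z pos pos pos _ = refl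
x·[y·z]≡pos⇒y≡x·z pos neg neg _ = refl
x·[y·z]≡pos⇒y≡x·z neg pos neg _ = refl
x·[y·z]≡pos⇒y≡x·z neg neg pos _ = refl

≢⇒·≡neg : ∀ {a b} → a ≢ b → a · b ≡ neg
≢⇒·≡neg {pos} {pos} a≢b = ⊥-elim (a≢b refl)
≢⇒·≡neg {pos} {neg} _ = refl
≢⇒·≡neg {neg} {pos} _ = refl
≢⇒·≡neg {neg} {neg} a≢b = ⊥-elim (a≢b refl)

±A : Sign → State
±A pos = A
±A neg = mA

±A≢Z : ∀ s → ±A s ≢ Z
±A≢Z pos ()
±A≢Z neg ()

±A≢C : ∀ s → ±A s ≢ C
±A≢C pos ()
±A≢C neg ()

uninformed? : (x : State) → Dec (x ≡ Z)
uninformed? A = no λ ()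
uninformed? mA = no λ ()
uninformed? C = no λ ()
uninformed? Z = yes refl

confused? : (x : State) → Dec (x ≡ C)
confused? A = no λ ()
confused? mA = no λ ()
confused? C = yes refl
confused? Z = no λ ()

message : Maybe Sign → State → Maybe State
message (just s) A = just (act s A)
message (just s) mA = just (act s mA)
message _ _ = nothing

deliver : Maybe State → Recv → Recv
deliver nothing r = r
deliver (just x) r = addRecv x r

send≡deliver : ∀ e x r → send e x r ≡ deliver (message e x) r
send≡deliver nothing x r = refl
send≡deliver (just s) A r = refl
send≡deliver (just s) mA r = refl
send≡deliver (just s) C r = refl
send≡deliver (just s) Z r = refl

message-Z : ∀ e → message e Z ≡ nothing
message-Z nothing = refl
message-Z (just _) = refl

message-±A : ∀ e s → message (just e) (±A s) ≡ just (±A (e · s))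
message-±A pos pos = refl
message-±A pos neg = refl
message-±A neg pos = refl
message-±A neg neg = refl

Heard : State → Recv → Set
Heard x r = r ≡ one x ⊎ r ≡ conflict

addRecv-heard : ∀ s r → Heard (±A s) (addRecv (±A s) r)
addRecv-heard s none = inj₁ refl
addRecv-heard pos (one A) = inj₁ refl
addRecv-heard pos (one mA) = inj₂ refl
addRecv-heard pos (one C) = inj₂ refl
addRecv-heard pos (one Z) = inj₂ refl
addRecv-heard neg (one A) = inj₂ refl
addRecv-heard neg (one mA) = inj₁ refl
addRecv-heard neg (one C) = inj₂ refl
addRecv-heard neg (one Z) = inj₂ refl
addRecv-heard s conflict = inj₂ refl

deliver-heard : ∀ s m {r} → Heard (±A s) r → Heard (±A s) (deliver m r)
deliver-heard s nothing h = h
deliver-heard s (just y) (inj₂ refl) = inj₂ refl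
deliver-heard pos (just A) (inj₁ refl) = inj₁ refl
deliver-heard pos (just mA) (inj₁ refl) = inj₂ refl
deliver-heard pos (just C) (inj₁ refl) = inj₂ refl
deliver-heard pos (just Z) (inj₁ refl) = inj₂ refl
deliver-heard neg (just A) (inj₁ refl) = inj₂ refl
deliver-heard neg (just mA) (inj₁ refl) = inj₁ refl
deliver-heard neg (just C) (inj₁ refl) = inj₂ refl
deliver-heard neg (just Z) (inj₁ refl) = inj₂ refl

heard-conflict : ∀ {r} → Heard A r → Heard mA r → r ≡ conflict
heard-conflict (inj₂ r≡conflict) _ = r≡conflict
heard-conflict (inj₁ refl) (inj₁ ())
heard-conflict (inj₁ refl) (inj₂ ())

update-heard : ∀ {s r} → Heard (±A s) r → update r ≢ Z
update-heard {s} (inj₁ refl) = ±A≢Z s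
update-heard (inj₂ refl) = λ ()

addRecv-uniform : ∀ s {r} → r ≡ none ⊎ r ≡ one (±A s) → addRecv (±A s) r ≡ one (±A s)
addRecv-uniform s (inj₁ refl) = refl
addRecv-uniform pos (inj₂ refl) = refl
addRecv-uniform neg (inj₂ refl) = refl

update-uniform : ∀ {x r} → r ≡ none ⊎ r ≡ one x → update r ≡ Z ⊎ update r ≡ x
update-uniform (inj₁ refl) = inj₁ refl
update-uniform (inj₂ refl) = inj₂ refl

module _ {A : Set} {P Q : Pred A 0ℓ} (P? : Decidable P) (Q? : Decidable Q) where

  length-filter-mono : P ⊆ Q → ∀ xs → length (filter P? xs) ≤ length (filter Q? xs)
  length-filter-mono P⊆Q xs = length-mono-≤ (filter⁺ P? Q? (λ { refl → P⊆Q }) (⊆-refl {x = xs}))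

  length-filter-strict : P ⊆ Q → ∀ {x xs} → x ∈ xs → ¬ P x → Q x →
                         length (filter P? xs) < length (filter Q? xs)
  length-filter-strict P⊆Q {xs = y ∷ xs} x∈ ¬px qx with P? y | Q? y | x∈
  ... | yes py | no ¬qy | _ = ⊥-elim (¬qy (P⊆Q py))
  ... | yes py | yes _ | here refl = ⊥-elim (¬px py)
  ... | no _ | no ¬qy | here refl = ⊥-elim (¬qy qx)
  ... | no _ | yes _ | here refl = s≤s (length-filter-mono P⊆Q xs)
  ... | yes _ | yes _ | there x∈xs = s≤s (length-filter-strict P⊆Q x∈xs ¬px qx)
  ... | no _ | yes _ | there x∈xs = m≤n⇒m≤1+n (length-filter-strict P⊆Q x∈xs ¬px qx)
  ... | no _ | no _ | there x∈xs = length-filter-strict P⊆Q x∈xs ¬px qx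

  length-filter-partition : (∀ x → P x ⊎ Q x) → (∀ {x} → P x → ¬ Q x) →
                            ∀ xs → length (filter P? xs) + length (filter Q? xs) ≡ length xs
  length-filter-partition P∪Q P∩Q [] = refl
  length-filter-partition P∪Q P∩Q (x ∷ xs) with P? x | Q? x
  ... | yes px | yes qx = ⊥-elim (P∩Q px qx)
  ... | yes _ | no _ = cong suc (length-filter-partition P∪Q P∩Q xs)
  ... | no _ | yes _ = trans (+-suc _ _) (cong suc (length-filter-partition P∪Q P∩Q xs))
  ... | no ¬px | no ¬qx = ⊥-elim ([ ¬px , ¬qx ]′ (P∪Q x))

module _ {A : Set} (_≟ᴬ_ : DecidableEquality A) {P : Pred A 0ℓ} (P? : Decidable P) where

  without? : ∀ x → Decidable (λ y → P y × y ≢ x)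
  without? x y = P? y ×-dec ¬? (y ≟ᴬ x)

  filter-without-absent : ∀ {x ys} → All (x ≢_) ys → filter (without? x) ys ≡ filter P? ys
  filter-without-absent [] = refl
  filter-without-absent {x} {y ∷ ys} (x≢y ∷ x∉ys) with P? y | y ≟ᴬ x
  ... | _ | yes refl = ⊥-elim (x≢y refl)
  ... | yes _ | no _ = cong (y ∷_) (filter-without-absent x∉ys)
  ... | no _ | no _ = filter-without-absent x∉ys

  length-filter-remove : ∀ {x xs} → Unique xs → x ∈ xs → P x →
                         length (filter P? xs) ≡ suc (length (filter (without? x) xs))
  length-filter-remove {x} {y ∷ ys} (y∉ys ∷ u) x∈ px with P? y | y ≟ᴬ x | x∈
  ... | _ | no y≢x | here y≡x = ⊥-elim (y≢x (sym y≡x))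
  ... | _ | yes refl | there x∈ys = ⊥-elim (All.lookup y∉ys x∈ys refl)
  ... | no ¬py | yes refl | here refl = ⊥-elim (¬py px)
  ... | yes _ | yes refl | here refl = cong (suc ∘ length) (sym (filter-without-absent y∉ys))
  ... | yes _ | no _ | there x∈ys = cong suc (length-filter-remove u x∈ys px)
  ... | no _ | no _ | there x∈ys = length-filter-remove u x∈ys px

count : ∀ {n} {P : Pred (Fin n) 0ℓ} → Decidable P → ℕ
count {n} P? = length (filter P? (allFin n))

#[_≡_] : ∀ {n} → (Fin n → Sign) → Sign → ℕ
#[ t ≡ s ] = count (λ v → t v ≟ˢ s)

module _ {n} {P : Pred (Fin n) 0ℓ} (P? : Decidable P) where

  count-none : (∀ v → ¬ P v) → count P? ≡ 0
  count-none ¬P = cong length (filter-none P? {allFin n} (All.tabulate λ {v} _ → ¬P v))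

  count-cong : ∀ {Q} (Q? : Decidable Q) → P ≐ Q → count P? ≡ count Q?
  count-cong Q? P≐Q = cong length (filter-≐ P? Q? P≐Q (allFin n))

  count-remove : ∀ {v} → P v → count P? ≡ suc (count (without? _≟_ P? v))
  count-remove pv = length-filter-remove _≟_ P? (allFin⁺ n) (∈-allFin _) pv

  count-witness : ∀ {v} → P v → 0 < count P?
  count-witness {v} pv = filter-some P? {allFin n} (lose (∈-allFin v) pv)

unique-++⁻ˡ : ∀ {A : Set} (xs : List A) {ys} → Unique (xs ++ ys) → Unique xs
unique-++⁻ˡ [] _ = []
unique-++⁻ˡ (x ∷ xs) (x∉ ∷ u) = ++⁻ˡ xs x∉ ∷ unique-++⁻ˡ xs u

unique-++⁻ʳ : ∀ {A : Set} (xs : List A) {ys} → Unique (xs ++ ys) → Unique ys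
unique-++⁻ʳ [] u = u
unique-++⁻ʳ (x ∷ xs) (_ ∷ u) = unique-++⁻ʳ xs u

Marking : ∀ {n} → SignedGraph n → (Fin n → Sign) → Set
Marking G t = ∀ {u v e} → edge G u v ≡ just e → e ≡ t u · t v

marking-switch : ∀ {n} {G : SignedGraph n} {t} → Marking G t → ∀ s → Marking G (λ v → s · t v)
marking-switch {t = t} mk s {u} {v} e = trans (mk e) (sym (·-switch s (t u) (t v)))

module _ {n} {G : SignedGraph n} where

  open DecMembership (_≟_ {n}) using (_∈?_)

  no-self-loop : ∀ {x s} → edge G x x ≢ just s
  no-self-loop {x} e with trans (sym (irrefl G x)) e
  ... | ()

  walkSign : ∀ {u v} → Walk G u v → Sign
  walkSign [] = pos
  walkSign ((s , _) ∷ w) = s · walkSign w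

  walk⇒pathSign : ∀ {u v} (w : Walk G u v) → ∃ λ xs → PathSign G u xs v (walkSign w)
  walk⇒pathSign [] = [] , end
  walk⇒pathSign ((_ , e) ∷ w) = let (xs , p) = walk⇒pathSign w in _ ∷ xs , step e p

  walk-crossing : ∀ (t : Fin n → Sign) {a b} → Walk G a b → t a ≡ pos → t b ≡ neg →
                  ∃₂ λ u x → t u ≡ pos × t x ≡ neg × Adj G u x
  walk-crossing t [] ta tb = ⊥-elim (pos≢neg (trans (sym ta) tb))
  walk-crossing t (_∷_ {v = a′} adj w) ta tb with t a′ ≟ˢ pos
  ... | yes ta′ = walk-crossing t w ta′ tb
  ... | no ta′ = _ , a′ , ta , ≢pos⇒≡neg ta′ , adj

  pathSign-++ : ∀ {x as w a bs z b} → PathSign G x as w a → PathSign G w bs z b →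
                PathSign G x (as ++ bs) z (a · b)
  pathSign-++ end q = q
  pathSign-++ (step {s = s} {t = t} e p) q =
    subst (PathSign G _ _ _) (sym (·-assoc s t _)) (step e (pathSign-++ p q))

  pathSign-split : ∀ {x bs z t} as → PathSign G x (as ++ bs) z t →
                   ∃₂ λ w a → ∃ λ b → PathSign G x as w a × PathSign G w bs z b × t ≡ a · b
  pathSign-split [] p = _ , pos , _ , end , p , refl
  pathSign-split (_ ∷ as) (step {s = s} e p) =
    let (w , a , b , p₁ , p₂ , t≡a·b) = pathSign-split as p
    in w , s · a , b , step e p₁ , p₂ , trans (cong (s ·_) t≡a·b) (sym (·-assoc s a b))

  pathSign-last : ∀ {x v z t} as → PathSign G x (as ++ [ v ]) z t → z ≡ v
  pathSign-last [] (step _ end) = refl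
  pathSign-last (_ ∷ as) (step _ p) = pathSign-last as p

  pathSign-end∈ : ∀ {x y ys z t} → PathSign G x (y ∷ ys) z t → z ∈ y ∷ ys
  pathSign-end∈ (step _ end) = here refl
  pathSign-end∈ (step _ p@(step _ _)) = there (pathSign-end∈ p)

  pathSign-reverse : ∀ {x xs z t} → PathSign G x xs z t → ∃ λ ys → PathSign G z ys x t
  pathSign-reverse end = [] , end
  pathSign-reverse {x} (step {y = y} {s = s} {t = t} e p) =
    let (ys , q) = pathSign-reverse p
    in ys ++ [ x ] , subst (PathSign G _ _ _) (trans (cong (t ·_) (·-identityʳ s)) (·-comm t s))
                           (pathSign-++ q (step (trans (symm G y x) e) end))

  pathSign-marking : ∀ {t x xs z s} → Marking G t → PathSign G x xs z s → s ≡ t x · t z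
  pathSign-marking {t} {x} mk end = sym (·-inverse (t x))
  pathSign-marking {t} {x} mk (step {y = y} {z = z} e p) =
    trans (cong₂ _·_ (mk e) (pathSign-marking {t = t} mk p)) (·-cancel-middle (t x) (t y) (t z))

  marking⇒balanced : ∀ {t} → Marking G t → Balanced G
  marking⇒balanced {t} mk (x ∷ _) _ (_ , _ , z , _ , _ , p , e , refl) =
    trans (cong₂ _·_ (pathSign-marking {t = t} mk p) (mk e))
          (trans (·-cancel-middle (t x) (t z) (t x)) (·-inverse (t x)))

  module _ (balanced : Balanced G) where

    loop-positive : ∀ {x y ys s t} → Unique (y ∷ ys) → edge G x y ≡ just s → PathSign G y ys x t →
                    s · t ≡ pos
    loop-positive _ e end = ⊥-elim (no-self-loop e)
    loop-positive {x} {y} {s = s} _ e (step e′ end)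
      with just-injective (trans (sym e) (trans (symm G x y) e′))
    ... | refl = trans (cong (s ·_) (·-identityʳ s)) (·-inverse s)
    loop-positive {x} {y} {ys} {s} {t} u e p@(step _ (step _ _)) =
      trans (·-comm s t) (balanced (y ∷ ys) (t · s) (u , s≤s (s≤s z≤n) , x , t , s , p , e , refl))

    cut-loop : ∀ {x y bs cs z s t} → edge G x y ≡ just s → Unique (y ∷ bs ++ x ∷ cs) →
               PathSign G y (bs ++ x ∷ cs) z t → PathSign G x cs z (s · t)
    cut-loop {x} {y} {bs} {cs} {s = s} e u p
      with pathSign-split (bs ∷ʳ x) (subst (λ l → PathSign G y l _ _) (sym (∷ʳ-++ bs x cs)) p)
    ... | w , a , c , loop , rest , refl with pathSign-last bs loop
    ... | refl = subst (PathSign G x cs _) (trans (cong (_· c) (sym loop-sign)) (·-assoc s a c)) rest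
      where
      loop-sign : s · a ≡ pos
      loop-sign = loop-positive (unique-++⁻ˡ (y ∷ bs ∷ʳ x) (subst Unique (cong (y ∷_) (sym (∷ʳ-++ bs x cs))) u))
                                e loop

    erase-loops : ∀ {x xs z t} → PathSign G x xs z t →
                  ∃ λ ys → Unique (x ∷ ys) × PathSign G x ys z t
    erase-loops end = [] , [] ∷ [] , end
    erase-loops {x} (step {y = y} e p) with erase-loops p
    ... | ys , u , q with x ∈? (y ∷ ys)
    ...   | no x∉ = y ∷ ys , ¬Any⇒All¬ _ x∉ ∷ u , step e q
    ...   | yes x∈ with ∈-∃++ x∈
    ...     | [] , cs , refl = ⊥-elim (no-self-loop e)
    ...     | _ ∷ bs , cs , refl = cs , unique-++⁻ʳ (y ∷ bs) u , cut-loop e u q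

    closed-walk-positive : ∀ {x xs t} → PathSign G x xs x t → t ≡ pos
    closed-walk-positive p with erase-loops p
    ... | [] , _ , end = refl
    ... | _ ∷ _ , u , q = ⊥-elim (Unique[x∷xs]⇒x∉xs u (pathSign-end∈ q))

    balanced⇒marking : Connected G → Fin n → ∃ (Marking G)
    balanced⇒marking connected r = t , marking
      where
      t : Fin n → Sign
      t v = walkSign (connected r v)
      marking : Marking G t
      marking {u} {v} {e} uv =
        let (_ , ru) = walk⇒pathSign (connected r u)
            (_ , vr) = pathSign-reverse (proj₂ (walk⇒pathSign (connected r v)))
        in x·[y·z]≡pos⇒y≡x·z (t u) e (t v) (closed-walk-positive (pathSign-++ ru (step uv vr)))

-- IsConfusionNumber G c unfolds to Least (Run G initial) c.
Least : (ℕ → Set) → ℕ → Set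
Least P k = P k × (∀ k′ → P k′ → k ≤ k′)

least : ∀ {P : Pred ℕ 0ℓ} → Decidable P → ∀ {k} → Acc _<_ k → P k → ∃ (Least P)
least P? {k} (acc below) pk with anyUpTo? P? k
... | yes (j , j<k , pj) = least P? (below j<k) pj
... | no none-below = k , pk , λ k′ pk′ → ≮⇒≥ λ k′<k → none-below (k′ , k′<k , pk′)

module Dissemination {n} (G : SignedGraph n) where

  incoming : Config n → Fin n → Fin n → Maybe State
  incoming c w z = message (edge G w z) (c z)

  hear : Config n → Fin n → List (Fin n) → Recv
  hear c w = foldr (λ z → send (edge G w z) (c z)) none

  module _ {c : Config n} {w : Fin n} where

    hear-silent : (∀ z → incoming c w z ≡ nothing) → ∀ zs → hear c w zs ≡ none
    hear-silent silent [] = refl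
    hear-silent silent (z ∷ zs)
      rewrite send≡deliver (edge G w z) (c z) (hear c w zs) | silent z = hear-silent silent zs

    hear-uniform : ∀ {s} → (∀ z → incoming c w z ≡ nothing ⊎ incoming c w z ≡ just (±A s)) →
                   ∀ zs → hear c w zs ≡ none ⊎ hear c w zs ≡ one (±A s)
    hear-uniform uniform [] = inj₁ refl
    hear-uniform {s} uniform (z ∷ zs) rewrite send≡deliver (edge G w z) (c z) (hear c w zs) with uniform z
    ... | inj₁ silent rewrite silent = hear-uniform uniform zs
    ... | inj₂ says rewrite says = inj₂ (addRecv-uniform s (hear-uniform uniform zs))

    hear-heard : ∀ s {z zs} → z ∈ zs → incoming c w z ≡ just (±A s) → Heard (±A s) (hear c w zs)
    hear-heard s {zs = z ∷ zs} (here refl) says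
      rewrite send≡deliver (edge G w z) (c z) (hear c w zs) | says = addRecv-heard s _
    hear-heard s {zs = z′ ∷ zs} (there z∈zs) says
      rewrite send≡deliver (edge G w z′) (c z′) (hear c w zs) =
        deliver-heard s (incoming c w z′) (hear-heard s z∈zs says)

  place-here : ∀ (c : Config n) v → place c v v ≡ A
  place-here c v with v ≟ v
  ... | yes _ = refl
  ... | no v≢v = ⊥-elim (v≢v refl)

  place-there : ∀ (c : Config n) {v w} → w ≢ v → place c v w ≡ c w
  place-there c {v} {w} w≢v with w ≟ v
  ... | yes w≡v = ⊥-elim (w≢v w≡v)
  ... | no _ = refl

  spread-informed : ∀ (c : Config n) {w} → c w ≢ Z → spread G c w ≡ c w
  spread-informed c {w} informed with c w
  ... | A = refl
  ... | mA = refl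
  ... | C = refl
  ... | Z = ⊥-elim (informed refl)

  spread-uninformed : ∀ (c : Config n) {w} → c w ≡ Z → spread G c w ≡ update (received G c w)
  spread-uninformed c {w} hz with c w
  spread-uninformed c refl | Z = refl

  step-placed : ∀ (c : Config n) v → stepID G c v v ≡ A
  step-placed c v =
    trans (spread-informed (place c v) {v} (±A≢Z pos ∘ trans (sym (place-here c v)))) (place-here c v)

  step-keeps : ∀ (c : Config n) {v w} → c v ≡ Z → c w ≢ Z → stepID G c v w ≡ c w
  step-keeps c {v} {w} hv informed =
    trans (spread-informed (place c v) {w} (λ hz → informed (trans (sym (place-there c w≢v)) hz)))
          (place-there c w≢v)
    where
    w≢v : w ≢ v
    w≢v refl = informed hv

  step-uninformed : ∀ (c : Config n) {v w} → w ≢ v → c w ≡ Z →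
                    stepID G c v w ≡ update (received G (place c v) w)
  step-uninformed c {v} {w} w≢v hz = spread-uninformed (place c v) {w} (trans (place-there c w≢v) hz)

  step-hears : ∀ (c : Config n) {v w z} s → w ≢ v → c w ≡ Z →
               incoming (place c v) w z ≡ just (±A s) → stepID G c v w ≢ Z
  step-hears c s w≢v hz says =
    update-heard (hear-heard s (∈-allFin _) says) ∘ trans (sym (step-uninformed c w≢v hz))

  step-conflict : ∀ (c : Config n) {v w z₁ z₂} → w ≢ v → c w ≡ Z →
                  incoming (place c v) w z₁ ≡ just A → incoming (place c v) w z₂ ≡ just mA →
                  stepID G c v w ≡ C
  step-conflict c w≢v hz says-A says-mA =
    trans (step-uninformed c w≢v hz)
          (cong update (heard-conflict (hear-heard pos (∈-allFin _) says-A)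
                                       (hear-heard neg (∈-allFin _) says-mA)))

  first-step-reaches : ∀ {u w e} → w ≢ u → edge G w u ≡ just e → stepID G initial u w ≢ Z
  first-step-reaches {u} {w} {e} w≢u wu =
    step-hears initial (e · pos) w≢u refl
               (trans (cong₂ message wu (place-here initial u)) (message-±A e pos))

  first-step-unreached : ∀ {u w} → w ≢ u → edge G w u ≡ nothing → stepID G initial u w ≡ Z
  first-step-unreached {u} {w} w≢u no-edge =
    trans (step-uninformed initial w≢u refl) (cong update (hear-silent silent (allFin n)))
    where
    silent : ∀ z → incoming (place initial u) w z ≡ nothing
    silent z with z ≟ u
    ... | yes refl = cong (λ e → message e A) no-edge
    ... | no _ = message-Z (edge G w z)

  _⟶_ : Config n → Config n → Set
  c ⟶ c′ = ∃ λ v → c v ≡ Z × stepID G c v ≡ c′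

  run-from : ∀ {c c′ k} → Star _⟶_ c c′ → Run G c′ k → Run G c k
  run-from ε r = r
  run-from ((v , hv , refl) ◅ steps) r = move v hv (run-from steps r)

  reach-keeps : ∀ {c c′ w} → Star _⟶_ c c′ → c w ≢ Z → c′ w ≡ c w
  reach-keeps ε _ = refl
  reach-keeps {c} ((v , hv , refl) ◅ steps) informed =
    trans (reach-keeps steps (informed ∘ trans (sym (step-keeps c hv informed)))) (step-keeps c hv informed)

  reach-uninformed : ∀ {c c′ w} → Star _⟶_ c c′ → c′ w ≡ Z → c w ≡ Z
  reach-uninformed {c} {w = w} steps hw with uninformed? (c w)
  ... | yes hz = hz
  ... | no informed = ⊥-elim (informed (trans (sym (reach-keeps steps informed)) hw))

  countC≡#confused : ∀ c → countC c ≡ count (λ v → confused? (c v))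
  countC≡#confused c = count-cong {n} _ (λ v → confused? (c v)) (id , id)

  #uninformed : Config n → ℕ
  #uninformed c = count (λ v → uninformed? (c v))

  #confusedOrUninformed : Config n → ℕ
  #confusedOrUninformed c = count (λ v → confused? (c v) ⊎-dec uninformed? (c v))

  #uninformed-step : ∀ {c v} → c v ≡ Z → #uninformed (stepID G c v) < #uninformed c
  #uninformed-step {c} {v} hv =
    length-filter-strict _ _ (reach-uninformed {c} ((v , hv , refl) ◅ ε)) (∈-allFin v)
                         (±A≢Z pos ∘ trans (sym (step-placed c v))) hv

  run-exists : ∀ c → Acc _<_ (#uninformed c) → ∃ (Run G c)
  run-exists c (acc below) with any? (λ v → uninformed? (c v))
  ... | no all-informed = countC c , done λ v hz → all-informed (v , hz)
  ... | yes (v , hv) = let (k , r) = run-exists (stepID G c v) (below (#uninformed-step hv)) in k , move v hv r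

  run? : ∀ c → Acc _<_ (#uninformed c) → Decidable (Run G c)
  run? c (acc below) k with any? (λ v → uninformed? (c v))
  ... | no all-informed =
    map′ (λ { refl → done λ v hz → all-informed (v , hz) })
         (λ { (done _) → refl ; (move v hv _) → ⊥-elim (all-informed (v , hv)) })
         (k ≟ℕ countC c)
  ... | yes (v₀ , hv₀) =
    map′ (λ (v , hv , r) → move v hv r)
         (λ { (done informed) → ⊥-elim (informed v₀ hv₀) ; (move v hv r) → v , hv , r })
         (any? continues?)
    where
    continues? : ∀ v → Dec (Σ (c v ≡ Z) λ _ → Run G (stepID G c v) k)
    continues? v with uninformed? (c v)
    ... | yes hv = map′ (hv ,_) proj₂ (run? (stepID G c v) (below (#uninformed-step hv)) k)
    ... | no informed = no (informed ∘ proj₁)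

  run-bound : ∀ {c k} → Run G c k → k ≤ #confusedOrUninformed c
  run-bound (done _) = length-filter-mono _ _ inj₁ (allFin n)
  run-bound {c} (move v hv r) =
    ≤-trans (run-bound r) (length-filter-mono _ _ was-confusedOrUninformed (allFin n))
    where
    was-confusedOrUninformed : ∀ {w} → stepID G c v w ≡ C ⊎ stepID G c v w ≡ Z →
                               c w ≡ C ⊎ c w ≡ Z
    was-confusedOrUninformed {w} cz with uninformed? (c w)
    ... | yes hz = inj₂ hz
    ... | no informed rewrite step-keeps c hv informed = cz

  confusion-number-exists : ∀ {k} → Run G initial k → Σ ℕ λ c → IsConfusionNumber G c × c ≤ k
  confusion-number-exists r =
    let (c , minimal) = least (run? initial (<-wellFounded _)) (<-wellFounded _) r
    in c , minimal , proj₂ minimal _ r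

module Strategy {n} {G : SignedGraph n} {t : Fin n → Sign} (marking : Marking G t) where

  open Dissemination G

  Consistent : Config n → Set
  Consistent c = ∀ w → c w ≡ Z ⊎ c w ≡ ±A (t w)

  consistent-initial : Consistent initial
  consistent-initial _ = inj₁ refl

  consistent-informed : ∀ {c w} → Consistent c → c w ≢ Z → c w ≡ ±A (t w)
  consistent-informed {w = w} cc informed with cc w
  ... | inj₁ hz = ⊥-elim (informed hz)
  ... | inj₂ hs = hs

  consistent-unconfused : ∀ {c w} → Consistent c → c w ≢ C
  consistent-unconfused {w = w} cc hc with cc w
  ... | inj₁ hz = case (trans (sym hc) hz) of λ ()
  ... | inj₂ hs = ±A≢C (t w) (trans (sym hs) hc)

  consistent-incoming : ∀ {c} → Consistent c → ∀ w z →
                        incoming c w z ≡ nothing ⊎ incoming c w z ≡ just (±A (t w))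
  consistent-incoming {c} cc w z with cc z | edge G w z in wz
  ... | inj₁ hz | e rewrite hz = inj₁ (message-Z e)
  ... | inj₂ _ | nothing = inj₁ refl
  ... | inj₂ hs | just e rewrite hs =
    inj₂ (trans (message-±A e (t z))
                (cong (just ∘ ±A) (trans (cong (_· t z) (marking wz)) (·-cancelʳ (t w) (t z)))))

  consistent-place : ∀ {c v} → Consistent c → t v ≡ pos → Consistent (place c v)
  consistent-place {c} {v} cc tv w with w ≟ v
  ... | yes refl = inj₂ (cong ±A (sym tv))
  ... | no _ = cc w

  consistent-spread : ∀ {c} → Consistent c → Consistent (spread G c)
  consistent-spread {c} cc w with uninformed? (c w)
  ... | no informed rewrite spread-informed c informed = cc w
  ... | yes hz rewrite spread-uninformed c hz =
    update-uniform (hear-uniform (consistent-incoming cc w) (allFin n))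

  consistent-step : ∀ {c v} → Consistent c → t v ≡ pos → Consistent (stepID G c v)
  consistent-step cc tv = consistent-spread (consistent-place cc tv)

  saturate : ∀ {c} → Consistent c → Acc _<_ (#uninformed c) →
             ∃ λ c′ → Star _⟶_ c c′ × Consistent c′ × (∀ w → c′ w ≡ Z → t w ≡ neg)
  saturate {c} cc (acc below) with any? (λ v → uninformed? (c v) ×-dec (t v ≟ˢ pos))
  ... | yes (v , hv , tv) =
    let (c′ , steps , cc′ , only-negative) = saturate (consistent-step cc tv) (below (#uninformed-step hv))
    in c′ , (v , hv , refl) ◅ steps , cc′ , only-negative
  ... | no no-positive = c , ε , cc , λ w hw → ≢pos⇒≡neg λ tw → no-positive (w , hw , tw)

  negative-placement-bound : ∀ {c w x} → Consistent c → (∀ z → c z ≡ Z → t z ≡ neg) →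
                             c w ≡ Z → t x ≡ neg → c x ≢ Z →
                             2 + #confusedOrUninformed (stepID G c w) ≤ #[ t ≡ neg ]
  -- confused-or-uninformed ⊊ confused-or-uninformed ∪ {x} ⊊ negative, witnessed by x and by w
  negative-placement-bound {c} {w} {x} cc only-negative hw tx informed =
    <-≤-trans (s≤s (length-filter-strict _ CZ-or-x? inj₁ (∈-allFin x) x∉CZ (inj₂ refl)))
              (length-filter-strict CZ-or-x? _ CZ-or-x⊆neg (∈-allFin w) w∉CZ-or-x (only-negative w hw))
    where
    c′ : Config n
    c′ = stepID G c w
    CZ-or-x? : Decidable (λ z → (c′ z ≡ C ⊎ c′ z ≡ Z) ⊎ z ≡ x)
    CZ-or-x? z = (confused? (c′ z) ⊎-dec uninformed? (c′ z)) ⊎-dec (z ≟ x)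
    not-CZ : ∀ z s → c′ z ≡ ±A s → ¬ (c′ z ≡ C ⊎ c′ z ≡ Z)
    not-CZ _ s hs (inj₁ hc) = ±A≢C s (trans (sym hs) hc)
    not-CZ _ s hs (inj₂ hz) = ±A≢Z s (trans (sym hs) hz)
    x∉CZ : ¬ (c′ x ≡ C ⊎ c′ x ≡ Z)
    x∉CZ = not-CZ x (t x) (trans (step-keeps c hw informed) (consistent-informed cc informed))
    CZ-or-x⊆neg : ∀ {z} → (c′ z ≡ C ⊎ c′ z ≡ Z) ⊎ z ≡ x → t z ≡ neg
    CZ-or-x⊆neg (inj₂ refl) = tx
    CZ-or-x⊆neg {z} (inj₁ cz) with uninformed? (c z)
    ... | yes hz = only-negative z hz
    ... | no informed′ =
      ⊥-elim (not-CZ z (t z) (trans (step-keeps c hw informed′) (consistent-informed cc informed′)) cz)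
    w∉CZ-or-x : ¬ ((c′ w ≡ C ⊎ c′ w ≡ Z) ⊎ w ≡ x)
    w∉CZ-or-x (inj₁ cz) = not-CZ w pos (step-placed c w) cz
    w∉CZ-or-x (inj₂ refl) = informed hw

  consistent-run : ∀ {c} → Consistent c →
                   (∀ w → t w ≡ neg → c w ≡ Z → ∃ λ x → t x ≡ neg × c x ≢ Z) →
                   ∃ λ k → Run G c k × (k ≡ 0 ⊎ 2 + k ≤ #[ t ≡ neg ])
  consistent-run {c} cc negative-informed with saturate cc (<-wellFounded _)
  ... | c′ , steps , cc′ , only-negative with any? (λ w → uninformed? (c′ w))
  ...   | no all-informed =
    countC c′ , run-from steps (done λ w hw → all-informed (w , hw)) ,
    inj₁ (count-none {n} _ λ w → consistent-unconfused cc′)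
  ...   | yes (w , hw) with negative-informed w (only-negative w hw) (reach-uninformed steps hw)
  ...     | x , tx , x-informed =
    let (k , r) = run-exists (stepID G c′ w) (<-wellFounded _)
        x-informed′ = λ hz → x-informed (trans (sym (reach-keeps steps x-informed)) hz)
    in k , run-from steps (move w hw r) ,
       inj₂ (≤-trans (+-monoʳ-≤ 2 (run-bound r))
                     (negative-placement-bound cc′ only-negative hw tx x-informed′))

  positive-exists : #[ t ≡ neg ] ≤ #[ t ≡ pos ] → ∀ {y} → t y ≡ neg → ∃ λ p → t p ≡ pos
  positive-exists neg≤pos ty with any? (λ p → t p ≟ˢ pos)
  ... | yes found = found
  ... | no no-positive =
    ⊥-elim (<⇒≢ (<-≤-trans (count-witness (λ v → t v ≟ˢ neg) ty) neg≤pos)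
                (sym (count-none (λ v → t v ≟ˢ pos) λ p tp → no-positive (p , tp))))

  strategy : Connected G → #[ t ≡ neg ] ≤ #[ t ≡ pos ] →
             ∃ λ k → Run G initial k × (k ≡ 0 ⊎ 2 + k ≤ #[ t ≡ neg ])
  strategy connected neg≤pos with any? (λ y → t y ≟ˢ neg)
  ... | no no-negative = consistent-run consistent-initial λ w tw _ → ⊥-elim (no-negative (w , tw))
  ... | yes (y , ty) with positive-exists neg≤pos ty
  ...   | p , tp with walk-crossing t (connected p y) tp ty
  ...     | u , x , tu , tx , (e , ux) =
    let (k , r , bound) = consistent-run (consistent-step consistent-initial tu)
                                         λ _ _ _ → x , tx , x-informed
    in k , move u refl r , bound
    where
    x≢u : x ≢ u
    x≢u refl = pos≢neg (trans (sym tu) tx)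
    x-informed : stepID G initial u x ≢ Z
    x-informed = first-step-reaches x≢u (trans (symm G x u) ux)

oriented-marking : ∀ {n} {G : SignedGraph n} {t} → Marking G t →
                   ∃ λ t′ → Marking G t′ × #[ t′ ≡ neg ] ≤ #[ t′ ≡ pos ]
oriented-marking {G = G} {t = t} marking with ≤-total #[ t ≡ neg ] #[ t ≡ pos ]
... | inj₁ neg≤pos = t , marking , neg≤pos
... | inj₂ pos≤neg =
  (λ v → neg · t v) , marking-switch {G = G} {t = t} marking neg ,
  subst₂ _≤_ (flip-count pos) (flip-count neg) pos≤neg
  where
  flip-count : ∀ s → #[ t ≡ s ] ≡ #[ (λ v → neg · t v) ≡ neg · s ]
  flip-count s =
    count-cong (λ v → t v ≟ˢ s) (λ v → neg · t v ≟ˢ neg · s) (cong (neg ·_) , ·-cancelˡ neg)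

sign-partition : ∀ {n} (t : Fin n → Sign) → #[ t ≡ neg ] + #[ t ≡ pos ] ≡ n
sign-partition {n} t =
  trans (length-filter-partition (λ v → t v ≟ˢ neg) (λ v → t v ≟ˢ pos) neg-or-pos neg≢pos
                                 (allFin n))
        (length-tabulate id)
  where
  neg-or-pos : ∀ v → t v ≡ neg ⊎ t v ≡ pos
  neg-or-pos v with t v
  ... | neg = inj₁ refl
  ... | pos = inj₂ refl
  neg≢pos : ∀ {v} → t v ≡ neg → t v ≢ pos
  neg≢pos tv tv′ = pos≢neg (trans (sym tv′) tv)

twice-smaller-part : ∀ {a b n} → a ≤ b → a + b ≡ n → 2 * a ≤ n
twice-smaller-part {a} {b} a≤b refl = begin
  2 * a  ≡⟨ cong (a +_) (+-identityʳ a) ⟩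
  a + a  ≤⟨ +-monoʳ-≤ a a≤b ⟩
  a + b  ∎
  where open ≤-Reasoning

strategy-bound : ∀ {k a n} → k ≡ 0 ⊎ 2 + k ≤ a → 2 * a ≤ n → 4 ≤ n → 2 * k + 4 ≤ n
strategy-bound (inj₁ refl) _ 4≤n = 4≤n
strategy-bound {k} {a} {n} (inj₂ 2+k≤a) 2a≤n _ = begin
  2 * k + 4    ≡⟨ +-comm (2 * k) 4 ⟩
  4 + 2 * k    ≡⟨ sym (*-distribˡ-+ 2 2 k) ⟩
  2 * (2 + k)  ≤⟨ *-monoʳ-≤ 2 2+k≤a ⟩
  2 * a        ≤⟨ 2a≤n ⟩
  n            ∎
  where open ≤-Reasoning

confusion-number-bound : ∀ n → 4 ≤ n → (G : SignedGraph n) → Connected G → Balanced G →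
                         Σ ℕ λ c → IsConfusionNumber G c × 2 * c + 4 ≤ n
confusion-number-bound (suc n) 4≤n G connected balanced =
  let (t₀ , marking₀) = balanced⇒marking balanced connected zero
      (t , marking , neg≤pos) = oriented-marking {G = G} {t = t₀} marking₀
      (k , r , k-bound) = Strategy.strategy {t = t} marking connected neg≤pos
      (c , is-confusion-number , c≤k) = Dissemination.confusion-number-exists G r
  in c , is-confusion-number ,
     ≤-trans (+-monoˡ-≤ 4 (*-monoʳ-≤ 2 c≤k))
             (strategy-bound k-bound (twice-smaller-part neg≤pos (sign-partition t)) 4≤n)

-- Unlike 2 * k, double (suc k) computes to suc (suc (double k)), so that Fin (double k) can be
-- split into pairs by pattern matching: vertex 2i lies on side pos and 2i + 1 on side neg, both
-- have index i, and they are each other's partner.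
double : ℕ → ℕ
double zero = zero
double (suc k) = suc (suc (double k))

double≡2* : ∀ k → double k ≡ 2 * k
double≡2* zero = refl
double≡2* (suc k) = trans (cong (2 +_) (double≡2* k)) (sym (*-suc 2 k))

side : ∀ {k} → Fin (double k) → Sign
side {suc k} zero = pos
side {suc k} (suc zero) = neg
side {suc k} (suc (suc v)) = side v

index : ∀ {k} → Fin (double k) → Fin k
index {suc k} zero = zero
index {suc k} (suc zero) = zero
index {suc k} (suc (suc v)) = suc (index v)

partner : ∀ {k} → Fin (double k) → Fin (double k)
partner {suc k} zero = suc zero
partner {suc k} (suc zero) = zero
partner {suc k} (suc (suc v)) = suc (suc (partner v))

side-partner : ∀ {k} (v : Fin (double k)) → side (partner v) ≢ side v
side-partner {suc k} zero ()
side-partner {suc k} (suc zero) ()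
side-partner {suc k} (suc (suc v)) = side-partner v

index-partner : ∀ {k} (v : Fin (double k)) → index (partner v) ≡ index v
index-partner {suc k} zero = refl
index-partner {suc k} (suc zero) = refl
index-partner {suc k} (suc (suc v)) = cong suc (index-partner v)

side-index-injective : ∀ {k} {u v : Fin (double k)} → side u ≡ side v → index u ≡ index v → u ≡ v
side-index-injective {suc k} {zero} {zero} _ _ = refl
side-index-injective {suc k} {suc zero} {suc zero} _ _ = refl
side-index-injective {suc k} {suc (suc u)} {suc (suc v)} same-side same-index =
  cong (λ w → suc (suc w)) (side-index-injective same-side (Fin-suc-injective same-index))
side-index-injective {suc k} {zero} {suc zero} () _
side-index-injective {suc k} {suc zero} {zero} () _
side-index-injective {suc k} {zero} {suc (suc _)} _ ()
side-index-injective {suc k} {suc zero} {suc (suc _)} _ ()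
side-index-injective {suc k} {suc (suc _)} {zero} _ ()
side-index-injective {suc k} {suc (suc _)} {suc zero} _ ()

side-count : ∀ σ {k k′} (f : Fin (double k) → Fin (double k′)) →
             (∀ v → side (f v) ≡ side v) →
             length (filter (λ v → side v ≟ˢ σ) (tabulate f)) ≡ k
side-count σ {zero} f _ = refl
side-count σ {suc k} f f-side with side (f zero) ≟ˢ σ
... | yes f0 with side (f (suc zero)) ≟ˢ σ
...   | yes f1 =
  ⊥-elim (pos≢neg (trans (sym (f-side zero)) (trans f0 (trans (sym f1) (f-side (suc zero))))))
...   | no _ = cong suc (side-count σ (λ v → f (suc (suc v))) (λ v → f-side (suc (suc v))))
side-count σ {suc k} f f-side | no f0 with side (f (suc zero)) ≟ˢ σ
...   | yes _ = cong suc (side-count σ (λ v → f (suc (suc v))) (λ v → f-side (suc (suc v))))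
...   | no f1 =
  ⊥-elim (pos≢neg (trans (sym (f-side zero)) (trans (≢-two-valued f0 f1) (f-side (suc zero)))))

module _ {k : ℕ} where

  Adjacent : Fin (double k) → Fin (double k) → Set
  Adjacent u v = u ≢ v × (side u ≡ side v ⊎ index u ≡ index v)

  adjacent? : ∀ u v → Dec (Adjacent u v)
  adjacent? u v = ¬? (u ≟ v) ×-dec (side u ≟ˢ side v ⊎-dec index u ≟ index v)

  adjacent-sym : ∀ {u v} → Adjacent u v → Adjacent v u
  adjacent-sym (u≢v , inj₁ same-side) = u≢v ∘ sym , inj₁ (sym same-side)
  adjacent-sym (u≢v , inj₂ same-index) = u≢v ∘ sym , inj₂ (sym same-index)

  partner-adjacent : ∀ u → Adjacent u (partner u)
  partner-adjacent u = (λ u≡p → side-partner u (cong side (sym u≡p))) , inj₂ (sym (index-partner u))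

  prism-edge : Fin (double k) → Fin (double k) → Maybe Sign
  prism-edge u v with adjacent? u v
  ... | yes _ = just (side u · side v)
  ... | no _ = nothing

  prism-edge-sym : ∀ u v → prism-edge u v ≡ prism-edge v u
  prism-edge-sym u v with adjacent? u v | adjacent? v u
  ... | yes _ | yes _ = cong just (·-comm (side u) (side v))
  ... | yes uv | no ¬vu = ⊥-elim (¬vu (adjacent-sym uv))
  ... | no ¬uv | yes vu = ⊥-elim (¬uv (adjacent-sym vu))
  ... | no _ | no _ = refl

  prism-edge-irrefl : ∀ u → prism-edge u u ≡ nothing
  prism-edge-irrefl u with adjacent? u u
  ... | yes (u≢u , _) = ⊥-elim (u≢u refl)
  ... | no _ = refl

prism : ∀ k → SignedGraph (double k)
prism k = record { edge = prism-edge ; symm = prism-edge-sym ; irrefl = prism-edge-irrefl }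

module _ {k : ℕ} where

  prism-adjacent : ∀ {u v} → Adjacent u v → edge (prism k) u v ≡ just (side u · side v)
  prism-adjacent {u} {v} uv with adjacent? u v
  ... | yes _ = refl
  ... | no ¬uv = ⊥-elim (¬uv uv)

  adjacent⇒Adj : ∀ {u v} → Adjacent u v → Adj (prism k) u v
  adjacent⇒Adj uv = _ , prism-adjacent uv

  prism-nonadjacent : ∀ {u v} → ¬ Adjacent u v → edge (prism k) u v ≡ nothing
  prism-nonadjacent {u} {v} ¬uv with adjacent? u v
  ... | yes uv = ⊥-elim (¬uv uv)
  ... | no _ = refl

  prism-same-side : ∀ {u v} → u ≢ v → side u ≡ side v → edge (prism k) u v ≡ just pos
  prism-same-side {u} u≢v same-side =
    trans (prism-adjacent (u≢v , inj₁ same-side))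
          (cong just (trans (cong (side u ·_) (sym same-side)) (·-inverse (side u))))

  prism-marking : Marking (prism k) side
  prism-marking {u} {v} uv with adjacent? u v
  ... | yes _ = just-injective (sym uv)
  ... | no _ = case uv of λ ()

  prism-connected : Connected (prism k)
  prism-connected u v with u ≟ v
  ... | yes refl = []
  ... | no u≢v with side u ≟ˢ side v
  ...   | yes same-side = adjacent⇒Adj (u≢v , inj₁ same-side) ∷ []
  ...   | no different with partner u ≟ v
  ...     | yes refl = adjacent⇒Adj (partner-adjacent u) ∷ []
  ...     | no p≢v =
    adjacent⇒Adj (partner-adjacent u) ∷
    adjacent⇒Adj (p≢v , inj₁ (≢-two-valued (side-partner u) (different ∘ sym))) ∷ []

module PrismRun (m : ℕ) where

  G : SignedGraph (double (2 + m))
  G = prism (2 + m)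

  open Dissemination G

  module FirstPlacement (u : Fin (double (2 + m))) where

    relative-side : Fin (double (2 + m)) → Sign
    relative-side v = side u · side v

    relative-marking : Marking G relative-side
    relative-marking = marking-switch {G = G} {t = side} prism-marking (side u)

    open Strategy {G = G} {t = relative-side} relative-marking

    c₁ : Config (double (2 + m))
    c₁ = stepID G initial u

    p : Fin (double (2 + m))
    p = partner u

    Unreached : Pred (Fin (double (2 + m))) 0ℓ
    Unreached v = side v ≢ side u × index v ≢ index u

    unreached? : Decidable Unreached
    unreached? v = ¬? (side v ≟ˢ side u) ×-dec ¬? (index v ≟ index u)

    c₁-consistent : Consistent c₁
    c₁-consistent = consistent-step consistent-initial (·-inverse (side u))

    c₁-uninformed : ∀ v → c₁ v ≡ Z → Unreached v
    c₁-uninformed v hv with adjacent? v u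
    ... | yes vu = ⊥-elim (first-step-reaches (proj₁ vu) (prism-adjacent vu) hv)
    ... | no ¬vu = (λ same-side → ¬vu (v≢u , inj₁ same-side)) ,
                   (λ same-index → ¬vu (v≢u , inj₂ same-index))
      where
      v≢u : v ≢ u
      v≢u refl = ±A≢Z pos (trans (sym (step-placed initial u)) hv)

    c₁-unreached : ∀ v → Unreached v → c₁ v ≡ Z
    c₁-unreached _ (other-side , other-index) =
      first-step-unreached (λ { refl → other-side refl })
                           (prism-nonadjacent λ (_ , same) → [ other-side , other-index ]′ same)

    c₁-partner : c₁ p ≡ mA
    c₁-partner =
      trans (consistent-informed {w = p} c₁-consistent informed) (cong ±A (≢⇒·≡neg (side-partner u ∘ sym)))
      where
      informed : c₁ p ≢ Z
      informed = first-step-reaches (proj₁ (partner-adjacent u) ∘ sym)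
                                    (prism-adjacent (adjacent-sym (partner-adjacent u)))

    unreached-exists : ∃ Unreached
    unreached-exists = choose (side u) (index u)
      where
      choose : ∀ σ (i : Fin (2 + m)) → ∃ λ v → side v ≢ σ × index v ≢ i
      choose pos zero = suc (suc (suc zero)) , (λ ()) , (λ ())
      choose pos (suc _) = suc zero , (λ ()) , (λ ())
      choose neg zero = suc (suc zero) , (λ ()) , (λ ())
      choose neg (suc _) = zero , (λ ()) , (λ ())

    unreached≐ : Unreached ≐ (λ v → side v ≡ side p × v ≢ p)
    unreached≐ = (λ (other-side , other-index) → ≢-two-valued other-side (side-partner u) ,
                                                 λ { refl → other-index (index-partner u) }) ,
                 (λ (same-side , v≢p) → (λ s → side-partner u (trans (sym same-side) s)) ,
                                        λ i → v≢p (side-index-injective same-side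
                                                                        (trans i (sym (index-partner u)))))

    module SecondPlacement (w : Fin (double (2 + m))) (hw : c₁ w ≡ Z) where

      c₂ : Config (double (2 + m))
      c₂ = stepID G c₁ w

      c₂-confused : ∀ {z} → c₁ z ≡ Z → z ≢ w → c₂ z ≡ C
      c₂-confused {z} hz z≢w = step-conflict c₁ z≢w hz from-w from-p
        where
        z≢p : z ≢ p
        z≢p refl = case trans (sym hz) c₁-partner of λ ()
        p≢w : p ≢ w
        p≢w refl = case trans (sym hw) c₁-partner of λ ()
        from-w : incoming (place c₁ w) z w ≡ just A
        from-w = cong₂ message (prism-same-side z≢w (≢-two-valued (proj₁ (c₁-uninformed z hz))
                                                                  (proj₁ (c₁-uninformed w hw))))
                               (place-here c₁ w)
        from-p : incoming (place c₁ w) z p ≡ just mA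
        from-p = cong₂ message (prism-same-side z≢p (≢-two-valued (proj₁ (c₁-uninformed z hz))
                                                                  (side-partner u)))
                               (trans (place-there c₁ p≢w) c₁-partner)

      c₂-informed : ∀ z → c₂ z ≢ Z
      c₂-informed z with uninformed? (c₁ z)
      ... | no informed = informed ∘ trans (sym (step-keeps c₁ {w} {z} hw informed))
      ... | yes hz = placed-or-confused (z ≟ w)
        where
        placed-or-confused : Dec (z ≡ w) → c₂ z ≢ Z
        placed-or-confused (yes refl) = ±A≢Z pos ∘ trans (sym (step-placed c₁ w))
        placed-or-confused (no z≢w) hz₂ = case trans (sym (c₂-confused hz z≢w)) hz₂ of λ ()

      c₂-confused≐ : (λ z → c₂ z ≡ C) ≐ (λ z → Unreached z × z ≢ w)
      c₂-confused≐ = confused⇒ , λ {z} (unreached , z≢w) → c₂-confused (c₁-unreached z unreached) z≢w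
        where
        confused⇒ : ∀ {z} → c₂ z ≡ C → Unreached z × z ≢ w
        confused⇒ {z} hc with uninformed? (c₁ z)
        ... | yes hz = c₁-uninformed z hz , λ { refl → case trans (sym (step-placed c₁ w)) hc of λ () }
        ... | no informed = ⊥-elim (consistent-unconfused {w = z} c₁-consistent
                                                         (trans (sym (step-keeps c₁ {w} {z} hw informed)) hc))

      countC-c₂ : countC c₂ ≡ m
      countC-c₂ = suc-injective (suc-injective (begin
        2 + countC c₂                        ≡⟨ cong (2 +_) (countC≡#confused c₂) ⟩
        2 + count confused-c₂?               ≡⟨ cong (2 +_) (count-cong confused-c₂? unreached∖w? c₂-confused≐) ⟩
        2 + count unreached∖w?               ≡⟨ cong suc (sym (count-remove unreached? (c₁-uninformed w hw))) ⟩
        1 + count unreached?                 ≡⟨ cong suc (count-cong unreached? other-side∖p? unreached≐) ⟩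
        1 + count other-side∖p?              ≡⟨ sym (count-remove other-side? refl) ⟩
        count other-side?                    ≡⟨ side-count (side p) id (λ _ → refl) ⟩
        2 + m                                ∎))
        where
        open ≡-Reasoning
        confused-c₂? : Decidable (λ z → c₂ z ≡ C)
        confused-c₂? z = confused? (c₂ z)
        unreached∖w? : Decidable (λ z → Unreached z × z ≢ w)
        unreached∖w? = without? _≟_ unreached? w
        other-side? : Decidable (λ v → side v ≡ side p)
        other-side? v = side v ≟ˢ side p
        other-side∖p? : Decidable (λ v → side v ≡ side p × v ≢ p)
        other-side∖p? = without? _≟_ other-side? p

  prism-run-value : ∀ {k} → Run G initial k → k ≡ m
  prism-run-value (done all-informed) = ⊥-elim (all-informed zero refl)
  prism-run-value (move u _ (done all-informed)) =
    let (v , unreached) = unreached-exists in ⊥-elim (all-informed v (c₁-unreached v unreached))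
    where open FirstPlacement u
  prism-run-value (move u _ (move w hw (done _))) = countC-c₂
    where open FirstPlacement.SecondPlacement u w hw
  prism-run-value (move u _ (move w hw (move z hz _))) = ⊥-elim (c₂-informed z hz)
    where open FirstPlacement.SecondPlacement u w hw

  prism-run : Run G initial m
  prism-run = move zero refl (move w hw (subst (Run G c₂) countC-c₂ (done c₂-informed)))
    where
    open FirstPlacement zero
    w : Fin (double (2 + m))
    w = proj₁ unreached-exists
    hw : c₁ w ≡ Z
    hw = c₁-unreached w (proj₂ unreached-exists)
    open SecondPlacement w hw

prism-example : ∀ m → Σ (SignedGraph (2 * m + 4)) λ G → Connected G × Balanced G × IsConfusionNumber G m
prism-example m =
  subst (λ N → Σ (SignedGraph N) λ G → Connected G × Balanced G × IsConfusionNumber G m)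
        (trans (cong (4 +_) (double≡2* m)) (+-comm 4 (2 * m)))
        (G , prism-connected , marking⇒balanced {t = side} prism-marking , prism-run ,
         λ k r → ≤-reflexive (sym (prism-run-value r)))
  where open PrismRun m

theorem2p3 : ((n : ℕ) → 4 ≤ n → (G : SignedGraph n) → Connected G → Balanced G →
    Σ ℕ λ c → IsConfusionNumber G c × 2 * c + 4 ≤ n)
    × ((m : ℕ) → Σ (SignedGraph (2 * m + 4)) λ G →
    Connected G × Balanced G × IsConfusionNumber G m)
theorem2p3 = confusion-number-bound , prism-example
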